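{- The session coalgebra of session types $(\mathsf{Type}, c_{\mathsf{Type}})$ is finitely generated, i.e., for every $T\in\mathsf{Type}$ the subcoalgebra $\langle T\rangle_{c_{\mathsf{Type}}}$ generated by $T$ is finite.
   Context: Fix a set $D$ of basic data types, a set $\mathbb{L}$ of labels and a countable set $\mathsf{Var}$ of type variables. Session types are generated by: qualifiers $q::=\mathrm{lin}\mid\mathrm{un}$; pretypes $p::= ?T.T \mid !T.T \mid \&\{l_i:T_i\}_{i\in I}\mid \oplus\{l_i:T_i\}_{i\in I}$ ($I$ finite nonempty, $l_i\in\mathbb{L}$ distinct); types $T::= d\ (d\in D)\mid \mathrm{end}\mid q\,p\mid X\ (X\in\mathsf{Var})\mid \mu X.T$. $\mathsf{Type}$ is the set of closed (no free type variables) and contractive (no subterm of the form $\mu X_1.\mu X_2\ldots\mu X_n.X_1$) types, up to $\alpha$-equivalence. Unfolding: $\mathit{unfold}(\mu X.T)=\mathit{unfold}(T[\mu X.T/X])$ and $\mathit{unfold}(T)=T$ otherwise. A session coalgebra is a set $X$ with a map $c$ assigning to each state $x$ a pair $(\sigma(x),\delta(x))$ where $\sigma(x)$ is one of $(\mathrm{com},p)$ ($p\in\{\mathrm{in},\mathrm{out}\}$), $(\mathrm{branch},p,L)$ ($L\subseteq\mathbb{L}$ finite nonempty), $\mathrm{end}$, $(\mathrm{bsc},d)$, $\mathrm{par}$, and $\delta(x)\colon B_{\sigma(x)}\to X$ with $B_{(\mathrm{com},p)}=\{*,1\}$, $B_{(\mathrm{branch},p,L)}=L$, $B_{\mathrm{end}}=B_{(\mathrm{bsc},d)}=\emptyset$,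 $B_{\mathrm{par}}=\{*\}$. It is finitely generated if for every $x$ the least subset $\langle x\rangle_c$ containing $x$ and closed under all transitions ($y\mapsto\delta(y)(\alpha)$) is finite. The coalgebra $c_{\mathsf{Type}}$ on $\mathsf{Type}$: $\mathrm{lin}\,?T.T'\mapsto((\mathrm{com},\mathrm{in}),\ *\mapsto T',\ 1\mapsto T)$; $\mathrm{lin}\,!T.T'\mapsto((\mathrm{com},\mathrm{out}),\ *\mapsto T',\ 1\mapsto T)$; $\mathrm{lin}\,\&\{l_i:T_i\}_{i\in I}\mapsto((\mathrm{branch},\mathrm{in},\{l_i\mid i\in I\}),\ l_i\mapsto T_i)$; $\mathrm{lin}\,\oplus\{l_i:T_i\}_{i\in I}\mapsto((\mathrm{branch},\mathrm{out},\{l_i\mid i\in I\}),\ l_i\mapsto T_i)$; $\mathrm{end}\mapsto(\mathrm{end},\emptyset)$; $d\mapsto((\mathrm{bsc},d),\emptyset)$; $\mathrm{un}\,p\mapsto(\mathrm{par},\ *\mapsto\mathrm{lin}\,p)$; $\mu X.T\mapsto c_{\mathsf{Type}}(\mathit{unfold}(\mu X.T))$. -}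

module Defs where

open import Data.Nat using (ℕ; zero; suc; _+_)
open import Data.Product using (Σ; _×_; _,_; proj₁; proj₂)
open import Data.List using (List; []; _∷_; map)
open import Data.List.Membership.Propositional using (_∈_)
open import Data.List.Relation.Unary.Any using (here; there)
open import Data.List.Relation.Unary.Unique.Propositional using (Unique)
open import Data.Empty using (⊥)
open import Data.Unit using (⊤; tt)
open import Relation.Binary.PropositionalEquality using (_≡_; _≢_)
open import Relation.Nullary using (¬_)
open import Function.Bundles using (_⇔_)

data Dir : Set where
  inp out : Dir

-- σ-components; D = basic data types, 𝕃 = labels
data Sig (D 𝕃 : Set) : Set where
  com    : Dir → Sig D 𝕃
  branch : Dir → List 𝕃 → Sig D 𝕃
  endS   : Sig D 𝕃
  bscS   : D → Sig D 𝕃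
  par    : Sig D 𝕃

data ComArg : Set where
  ⋆ one : ComArg

B : {D 𝕃 : Set} → Sig D 𝕃 → Set
B (com _)        = ComArg
B {𝕃 = 𝕃} (branch _ L) = Σ 𝕃 (λ l → l ∈ L)
B endS           = ⊥
B (bscS _)       = ⊥
B par            = ⊤

Coalg : (D 𝕃 X : Set) → Set
Coalg D 𝕃 X = X → Σ (Sig D 𝕃) (λ s → B s → X)

data Gen {D 𝕃 X : Set} (c : Coalg D 𝕃 X) (x : X) : X → Set where
  base : Gen c x x
  step : ∀ {y} → Gen c x y → (α : B (proj₁ (c y))) → Gen c x (proj₂ (c y) α)

IsFinite : {X : Set} → (X → Set) → Set
IsFinite {X} P = Σ (List X) (λ xs → (y : X) → P y ⇔ (y ∈ xs))

-- Session types, de Bruijn syntax (α-equivalence = syntactic equality)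

data Qual : Set where
  lin un : Qual

data Ty (D 𝕃 : Set) : Set
data Pre (D 𝕃 : Set) : Set

data Ty D 𝕃 where
  bsc : D → Ty D 𝕃
  end : Ty D 𝕃
  qp  : Qual → Pre D 𝕃 → Ty D 𝕃
  var : ℕ → Ty D 𝕃
  mu  : Ty D 𝕃 → Ty D 𝕃

data Pre D 𝕃 where
  recv send : Ty D 𝕃 → Ty D 𝕃 → Pre D 𝕃
  bra  sel  : List (𝕃 × Ty D 𝕃) → Pre D 𝕃

module _ {D 𝕃 : Set} where

  private
    T = Ty D 𝕃

  ext : (ℕ → ℕ) → ℕ → ℕ
  ext ρ zero    = zero
  ext ρ (suc n) = suc (ρ n)

  renT : (ℕ → ℕ) → Ty D 𝕃 → Ty D 𝕃
  renP : (ℕ → ℕ) → Pre D 𝕃 → Pre D 𝕃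
  renB : (ℕ → ℕ) → List (𝕃 × Ty D 𝕃) → List (𝕃 × Ty D 𝕃)
  renT ρ (bsc d)  = bsc d
  renT ρ end      = end
  renT ρ (qp q p) = qp q (renP ρ p)
  renT ρ (var i)  = var (ρ i)
  renT ρ (mu t)   = mu (renT (ext ρ) t)
  renP ρ (recv a b) = recv (renT ρ a) (renT ρ b)
  renP ρ (send a b) = send (renT ρ a) (renT ρ b)
  renP ρ (bra bs)   = bra (renB ρ bs)
  renP ρ (sel bs)   = sel (renB ρ bs)
  renB ρ []             = []
  renB ρ ((l , t) ∷ bs) = (l , renT ρ t) ∷ renB ρ bs

  exts : (ℕ → Ty D 𝕃) → ℕ → Ty D 𝕃
  exts σ zero    = var zero
  exts σ (suc n) = renT suc (σ n)

  subT : (ℕ → Ty D 𝕃) → Ty D 𝕃 → Ty D 𝕃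
  subP : (ℕ → Ty D 𝕃) → Pre D 𝕃 → Pre D 𝕃
  subB : (ℕ → Ty D 𝕃) → List (𝕃 × Ty D 𝕃) → List (𝕃 × Ty D 𝕃)
  subT σ (bsc d)  = bsc d
  subT σ end      = end
  subT σ (qp q p) = qp q (subP σ p)
  subT σ (var i)  = σ i
  subT σ (mu t)   = mu (subT (exts σ) t)
  subP σ (recv a b) = recv (subT σ a) (subT σ b)
  subP σ (send a b) = send (subT σ a) (subT σ b)
  subP σ (bra bs)   = bra (subB σ bs)
  subP σ (sel bs)   = sel (subB σ bs)
  subB σ []             = []
  subB σ ((l , t) ∷ bs) = (l , subT σ t) ∷ subB σ bs

  single : Ty D 𝕃 → ℕ → Ty D 𝕃
  single u zero    = u
  single u (suc n) = var n

  _[_] : Ty D 𝕃 → Ty D 𝕃 → Ty D 𝕃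
  t [ u ] = subT (single u) t

  -- immediate subterms; k = number of binders crossed (1 under μ)
  data Child : ℕ → Ty D 𝕃 → Ty D 𝕃 → Set where
    c-mu    : ∀ {t} → Child 1 t (mu t)
    c-recvL : ∀ {q a b} → Child 0 a (qp q (recv a b))
    c-recvR : ∀ {q a b} → Child 0 b (qp q (recv a b))
    c-sendL : ∀ {q a b} → Child 0 a (qp q (send a b))
    c-sendR : ∀ {q a b} → Child 0 b (qp q (send a b))
    c-bra   : ∀ {q l s bs} → (l , s) ∈ bs → Child 0 s (qp q (bra bs))
    c-sel   : ∀ {q l s bs} → (l , s) ∈ bs → Child 0 s (qp q (sel bs))

  data _⊑_ : Ty D 𝕃 → Ty D 𝕃 → Set where
    ⊑-refl : ∀ {t} → t ⊑ t
    ⊑-step : ∀ {k s u t} → Child k s u → u ⊑ t → s ⊑ t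

  data Free : ℕ → Ty D 𝕃 → Set where
    f-var   : ∀ {i} → Free i (var i)
    f-child : ∀ {k i s t} → Child k s t → Free (k + i) s → Free i t

  Closed : Ty D 𝕃 → Set
  Closed t = ∀ i → ¬ Free i t

  -- LoopAt k t : t = μX_{k+2}...μX_n. X_1  (de Bruijn)
  LoopAt : ℕ → Ty D 𝕃 → Set
  LoopAt k (var i) = i ≡ k
  LoopAt k (mu t)  = LoopAt (suc k) t
  LoopAt k _       = ⊥

  -- t has the form μX_1.μX_2...μX_n.X_1 (n ≥ 1)
  Loop : Ty D 𝕃 → Set
  Loop (mu t) = LoopAt 0 t
  Loop _      = ⊥

  Contractive : Ty D 𝕃 → Set
  Contractive t = ∀ s → s ⊑ t → ¬ Loop s

  BranchOK : Ty D 𝕃 → Set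
  BranchOK (qp q (bra bs)) = (bs ≢ []) × Unique (map proj₁ bs)
  BranchOK (qp q (sel bs)) = (bs ≢ []) × Unique (map proj₁ bs)
  BranchOK _               = ⊤

  WellFormed : Ty D 𝕃 → Set
  WellFormed t = ∀ s → s ⊑ t → BranchOK s

  -- unfolding; fuel = number of leading μ's (suffices for contractive types)
  muDepth : Ty D 𝕃 → ℕ
  muDepth (mu t) = suc (muDepth t)
  muDepth _      = zero

  unfoldN : ℕ → Ty D 𝕃 → Ty D 𝕃
  unfoldN zero    t        = t
  unfoldN (suc n) (mu t)   = unfoldN n (t [ mu t ])
  unfoldN (suc n) (bsc d)  = bsc d
  unfoldN (suc n) end      = end
  unfoldN (suc n) (qp q p) = qp q p
  unfoldN (suc n) (var i)  = var i

  unfold : Ty D 𝕃 → Ty D 𝕃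
  unfold t = unfoldN (muDepth t) t

  lookupLbl : ∀ {l} (bs : List (𝕃 × Ty D 𝕃)) → l ∈ map proj₁ bs → Ty D 𝕃
  lookupLbl ((_ , t) ∷ bs) (here _)  = t
  lookupLbl (_ ∷ bs)       (there m) = lookupLbl bs m

  cNoMu : Coalg D 𝕃 (Ty D 𝕃)
  cNoMu (bsc d)              = bscS d , λ ()
  cNoMu end                  = endS , λ ()
  cNoMu (qp lin (recv a b))  = com inp , λ { ⋆ → b ; one → a }
  cNoMu (qp lin (send a b))  = com out , λ { ⋆ → b ; one → a }
  cNoMu (qp lin (bra bs))    = branch inp (map proj₁ bs) , λ { (l , m) → lookupLbl bs m }
  cNoMu (qp lin (sel bs))    = branch out (map proj₁ bs) , λ { (l , m) → lookupLbl bs m }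
  cNoMu (qp un p)            = par , λ _ → qp lin p
  -- the next two cases never arise for closed contractive types (arbitrary)
  cNoMu (var i)              = endS , λ ()
  cNoMu (mu t)               = endS , λ ()

  cType : Coalg D 𝕃 (Ty D 𝕃)
  cType t = cNoMu (unfold t)

module Submission where

-- Every state reachable from T lies in a finite list: the subterms of T in which each variable
-- bound by a μ is replaced by that μ-type. The list is closed under transitions because, by the
-- substitution lemma, unfolding such an instantiated μ-type again gives an instantiated subterm.
-- A transition-closed finite list yields a finite enumeration of the reachable states by
-- breadth-first search: a reachable state is reached by a path repeating no position of the
-- list, hence within as many steps as the list is long.

open import Defs

open import Data.Fin using (Fin)
open import Data.Fin.Properties using (injective⇒≤) renaming (_≟_ to _≟ᶠ_)
open import Data.List using (List; []; _∷_; _++_; map; concatMap; length; lookup)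
open import Data.List.Membership.Propositional using (_∈_; find)
open import Data.List.Membership.Propositional.Properties
  using (∈-++⁺ˡ; ∈-++⁺ʳ; ∈-++⁻; ∈-map⁺; ∈-map⁻; ∈-concatMap⁺; ∈-concatMap⁻; ∈-lookup)
open import Data.List.Relation.Binary.Subset.Propositional using (_⊆_)
open import Data.List.Relation.Unary.All as All using (All; []; _∷_)
open import Data.List.Relation.Unary.All.Properties using (++⁺)
open import Data.List.Relation.Unary.Any as Any using (here; there; index)
open import Data.List.Relation.Unary.Any.Properties using (lookup-index)
open import Data.Nat using (ℕ; zero; suc; _<_; _≤′_; ≤′-refl; ≤′-step)
open import Data.Nat.Properties using (<⇒≤; ≤⇒≤′)
open import Data.Product using (∃; ∃₂; _×_; _,_; proj₁; proj₂; map₂)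
open import Data.Sum using (inj₁; inj₂)
open import Data.Unit using (tt)
open import Data.Vec using (Vec; []; _∷_)
import Data.Vec.Relation.Unary.All as Vec
open import Data.Vec.Relation.Unary.Any as VecAny using ()
open import Data.Vec.Relation.Unary.AllPairs using (_∷_) renaming ([] to []ᴾ)
open import Data.Vec.Relation.Unary.Unique.Propositional using (Unique)
open import Data.Vec.Relation.Unary.Unique.Propositional.Properties using (lookup-injective)
open import Function using (_∘_)
open import Function.Bundles using (mk⇔)
open import Relation.Nullary using (yes; no)
open import Relation.Binary.PropositionalEquality
  using (_≡_; _≢_; _≗_; refl; sym; trans; cong; cong₂; subst; module ≡-Reasoning)

module Reachability {n : ℕ} (edges : Fin n → List (Fin n)) (source : Fin n) where

  open import Data.Vec.Membership.DecPropositional (_≟ᶠ_ {n})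
    using () renaming (_∈_ to _∈ᵥ_; _∉_ to _∉ᵥ_; _∈?_ to _∈ᵥ?_)

  data Reachable : Fin n → Set where
    start : Reachable source
    step  : ∀ {i j} → Reachable i → j ∈ edges i → Reachable j

  within : ℕ → List (Fin n)
  within zero    = source ∷ []
  within (suc k) = within k ++ concatMap edges (within k)

  within-mono : ∀ {a b} → a ≤′ b → within a ⊆ within b
  within-mono ≤′-refl         = λ i∈ → i∈
  within-mono (≤′-step a≤′b) = ∈-++⁺ˡ ∘ within-mono a≤′b

  within-step : ∀ k {i j} → i ∈ within k → j ∈ edges i → j ∈ within (suc k)
  within-step k i∈ j∈ = ∈-++⁺ʳ (within k) (∈-concatMap⁺ edges (Any.map (λ { refl → j∈ }) i∈))

  within⇒Reachable : ∀ k {i} → i ∈ within k → Reachable i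
  within⇒Reachable zero (here refl) = start
  within⇒Reachable (suc k) i∈ with ∈-++⁻ (within k) i∈
  ... | inj₁ i∈k = within⇒Reachable k i∈k
  ... | inj₂ i∈next with find (∈-concatMap⁻ edges i∈next)
  ...   | _ , h∈k , i∈edges = step (within⇒Reachable k h∈k) i∈edges

  -- The vector lists the earlier vertices of the path, most recent first.
  data SimplePath : Fin n → ∀ {k} → Vec (Fin n) k → Set where
    start  : SimplePath source []
    extend : ∀ {i j k} {vs : Vec (Fin n) k} →
             SimplePath i vs → j ∈ edges i → j ∉ᵥ i ∷ vs → SimplePath j (i ∷ vs)

  SimplePath⇒Unique : ∀ {i k} {vs : Vec (Fin n) k} → SimplePath i vs → Unique (i ∷ vs)
  SimplePath⇒Unique start            = Vec.[] ∷ []ᴾ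
  SimplePath⇒Unique (extend p _ j∉) = ∉⇒All≢ j∉ ∷ SimplePath⇒Unique p
    where
      ∉⇒All≢ : ∀ {j k} {vs : Vec (Fin n) k} → j ∉ᵥ vs → Vec.All (j ≢_) vs
      ∉⇒All≢ {vs = []}     _  = Vec.[]
      ∉⇒All≢ {vs = _ ∷ _} j∉ = (j∉ ∘ VecAny.here) Vec.∷ ∉⇒All≢ (j∉ ∘ VecAny.there)

  SimplePath⇒length< : ∀ {i k} {vs : Vec (Fin n) k} → SimplePath i vs → k < n
  SimplePath⇒length< p = injective⇒≤ (λ {a b} → lookup-injective (SimplePath⇒Unique p) a b)

  SimplePath⇒within : ∀ {i k} {vs : Vec (Fin n) k} → SimplePath i vs → i ∈ within k
  SimplePath⇒within start                    = here refl
  SimplePath⇒within (extend {k = k} p j∈ _) = within-step k (SimplePath⇒within p) j∈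

  SimplePath-suffix : ∀ {i j k} {vs : Vec (Fin n) k} → SimplePath i vs → j ∈ᵥ i ∷ vs →
                      ∃₂ λ l (ws : Vec (Fin n) l) → SimplePath j ws
  SimplePath-suffix p              (VecAny.here refl) = _ , _ , p
  SimplePath-suffix (extend p _ _) (VecAny.there j∈)  = SimplePath-suffix p j∈

  -- A cycle is cut off as soon as a vertex is revisited.
  Reachable⇒SimplePath : ∀ {j} → Reachable j → ∃₂ λ k (vs : Vec (Fin n) k) → SimplePath j vs
  Reachable⇒SimplePath start = _ , _ , start
  Reachable⇒SimplePath (step {i} {j} r j∈) with Reachable⇒SimplePath r
  ... | _ , vs , p with j ∈ᵥ? i ∷ vs
  ...   | yes j∈vs = SimplePath-suffix p j∈vs
  ...   | no  j∉vs = _ , _ , extend p j∈ j∉vs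

  Reachable⇒within : ∀ {i} → Reachable i → i ∈ within n
  Reachable⇒within r with Reachable⇒SimplePath r
  ... | _ , _ , p = within-mono (≤⇒≤′ (<⇒≤ (SimplePath⇒length< p))) (SimplePath⇒within p)

members : {A : Set} (xs : List A) → List (∃ (_∈ xs))
members []       = []
members (x ∷ xs) = (x , here refl) ∷ map (map₂ there) (members xs)

∈-members : {A : Set} (xs : List A) (p : ∃ (_∈ xs)) → p ∈ members xs
∈-members (x ∷ xs) (_ , here refl) = here refl
∈-members (x ∷ xs) (y , there y∈)  = there (∈-map⁺ (map₂ there) (∈-members xs (y , y∈)))

module _ {D 𝕃 : Set} where

  allB : (s : Sig D 𝕃) → List (B s)
  allB (com _)      = ⋆ ∷ one ∷ []
  allB (branch _ L) = members L
  allB endS         = []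
  allB (bscS _)     = []
  allB par          = tt ∷ []

  ∈-allB : (s : Sig D 𝕃) (α : B s) → α ∈ allB s
  ∈-allB (com _)      ⋆  = here refl
  ∈-allB (com _)      one = there (here refl)
  ∈-allB (branch _ L) α  = ∈-members L α
  ∈-allB par          tt = here refl

-- X need not have decidable equality, so reachability is computed on positions in L.
isFinite-Gen : {D 𝕃 X : Set} (c : Coalg D 𝕃 X) (L : List X) →
               (∀ {y} → y ∈ L → (α : B (proj₁ (c y))) → proj₂ (c y) α ∈ L) →
               ∀ {x} → x ∈ L → IsFinite (Gen c x)
isFinite-Gen {X = X} c L closed {x} x∈L =
  map state (within (length L)) , λ y → mk⇔ Gen⇒∈ ∈⇒Gen
  where
    state : Fin (length L) → X
    state = lookup L

    next : (i : Fin (length L)) → B (proj₁ (c (state i))) → Fin (length L)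
    next i α = index (closed (∈-lookup i) α)

    next-state : ∀ i α → proj₂ (c (state i)) α ≡ state (next i α)
    next-state i α = lookup-index (closed (∈-lookup i) α)

    open Reachability (λ i → map (next i) (allB _)) (index x∈L)

    Gen⇒Reachable : ∀ {y} → Gen c x y → ∃ λ i → Reachable i × y ≡ state i
    Gen⇒Reachable base = index x∈L , start , lookup-index x∈L
    Gen⇒Reachable (step g α) with Gen⇒Reachable g
    ... | i , r , refl = next i α , step r (∈-map⁺ (next i) (∈-allB _ α)) , next-state i α

    Reachable⇒Gen : ∀ {i} → Reachable i → Gen c x (state i)
    Reachable⇒Gen start = subst (Gen c x) (lookup-index x∈L) base
    Reachable⇒Gen (step {i} r j∈) with ∈-map⁻ (next i) j∈
    ... | α , _ , refl = subst (Gen c x) (next-state i α) (step (Reachable⇒Gen r) α)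

    Gen⇒∈ : ∀ {y} → Gen c x y → y ∈ map state (within (length L))
    Gen⇒∈ g with Gen⇒Reachable g
    ... | i , r , refl = ∈-map⁺ state (Reachable⇒within r)

    ∈⇒Gen : ∀ {y} → y ∈ map state (within (length L)) → Gen c x y
    ∈⇒Gen y∈ with ∈-map⁻ state y∈
    ... | i , i∈ , refl = Reachable⇒Gen (within⇒Reachable (length L) i∈)

module _ {D 𝕃 : Set} where

  private
    T  = Ty D 𝕃
    P  = Pre D 𝕃
    Bs = List (𝕃 × Ty D 𝕃)

    ext′ : (ℕ → ℕ) → ℕ → ℕ
    ext′ = ext {D} {𝕃}

  infixr 5 _∷ₛ_

  _∷ₛ_ : T → (ℕ → T) → ℕ → T
  (u ∷ₛ σ) zero    = u
  (u ∷ₛ σ) (suc i) = σ i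

  renT-fusion : ∀ ρ ρ′ ρ″ → ρ ∘ ρ′ ≗ ρ″ → (t : T) → renT ρ (renT ρ′ t) ≡ renT ρ″ t
  renP-fusion : ∀ ρ ρ′ ρ″ → ρ ∘ ρ′ ≗ ρ″ → (p : P) → renP ρ (renP ρ′ p) ≡ renP ρ″ p
  renB-fusion : ∀ ρ ρ′ ρ″ → ρ ∘ ρ′ ≗ ρ″ → (bs : Bs) → renB ρ (renB ρ′ bs) ≡ renB ρ″ bs
  renT-fusion ρ ρ′ ρ″ h (bsc d)  = refl
  renT-fusion ρ ρ′ ρ″ h end      = refl
  renT-fusion ρ ρ′ ρ″ h (qp q p) = cong (qp q) (renP-fusion ρ ρ′ ρ″ h p)
  renT-fusion ρ ρ′ ρ″ h (var i)  = cong var (h i)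
  renT-fusion ρ ρ′ ρ″ h (mu t)   =
    cong mu (renT-fusion (ext′ ρ) (ext′ ρ′) (ext′ ρ″) h′ t)
    where
      h′ : ext′ ρ ∘ ext′ ρ′ ≗ ext′ ρ″
      h′ zero    = refl
      h′ (suc i) = cong suc (h i)
  renP-fusion ρ ρ′ ρ″ h (recv a b) = cong₂ recv (renT-fusion ρ ρ′ ρ″ h a) (renT-fusion ρ ρ′ ρ″ h b)
  renP-fusion ρ ρ′ ρ″ h (send a b) = cong₂ send (renT-fusion ρ ρ′ ρ″ h a) (renT-fusion ρ ρ′ ρ″ h b)
  renP-fusion ρ ρ′ ρ″ h (bra bs)   = cong bra (renB-fusion ρ ρ′ ρ″ h bs)
  renP-fusion ρ ρ′ ρ″ h (sel bs)   = cong sel (renB-fusion ρ ρ′ ρ″ h bs)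
  renB-fusion ρ ρ′ ρ″ h []             = refl
  renB-fusion ρ ρ′ ρ″ h ((l , t) ∷ bs) =
    cong₂ (λ t′ bs′ → (l , t′) ∷ bs′) (renT-fusion ρ ρ′ ρ″ h t) (renB-fusion ρ ρ′ ρ″ h bs)

  subT-renT-fusion : ∀ τ ρ υ → τ ∘ ρ ≗ υ → (t : T) → subT τ (renT ρ t) ≡ subT υ t
  subP-renP-fusion : ∀ τ ρ υ → τ ∘ ρ ≗ υ → (p : P) → subP τ (renP ρ p) ≡ subP υ p
  subB-renB-fusion : ∀ τ ρ υ → τ ∘ ρ ≗ υ → (bs : Bs) → subB τ (renB ρ bs) ≡ subB υ bs
  subT-renT-fusion τ ρ υ h (bsc d)  = refl
  subT-renT-fusion τ ρ υ h end      = refl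
  subT-renT-fusion τ ρ υ h (qp q p) = cong (qp q) (subP-renP-fusion τ ρ υ h p)
  subT-renT-fusion τ ρ υ h (var i)  = h i
  subT-renT-fusion τ ρ υ h (mu t)   =
    cong mu (subT-renT-fusion (exts τ) (ext′ ρ) (exts υ) h′ t)
    where
      h′ : exts τ ∘ ext′ ρ ≗ exts υ
      h′ zero    = refl
      h′ (suc i) = cong (renT suc) (h i)
  subP-renP-fusion τ ρ υ h (recv a b) =
    cong₂ recv (subT-renT-fusion τ ρ υ h a) (subT-renT-fusion τ ρ υ h b)
  subP-renP-fusion τ ρ υ h (send a b) =
    cong₂ send (subT-renT-fusion τ ρ υ h a) (subT-renT-fusion τ ρ υ h b)
  subP-renP-fusion τ ρ υ h (bra bs) = cong bra (subB-renB-fusion τ ρ υ h bs)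
  subP-renP-fusion τ ρ υ h (sel bs) = cong sel (subB-renB-fusion τ ρ υ h bs)
  subB-renB-fusion τ ρ υ h []             = refl
  subB-renB-fusion τ ρ υ h ((l , t) ∷ bs) =
    cong₂ (λ t′ bs′ → (l , t′) ∷ bs′) (subT-renT-fusion τ ρ υ h t) (subB-renB-fusion τ ρ υ h bs)

  renT-subT-fusion : ∀ ρ σ υ → renT ρ ∘ σ ≗ υ → (t : T) → renT ρ (subT σ t) ≡ subT υ t
  renP-subP-fusion : ∀ ρ σ υ → renT ρ ∘ σ ≗ υ → (p : P) → renP ρ (subP σ p) ≡ subP υ p
  renB-subB-fusion : ∀ ρ σ υ → renT ρ ∘ σ ≗ υ → (bs : Bs) → renB ρ (subB σ bs) ≡ subB υ bs
  renT-subT-fusion ρ σ υ h (bsc d)  = refl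
  renT-subT-fusion ρ σ υ h end      = refl
  renT-subT-fusion ρ σ υ h (qp q p) = cong (qp q) (renP-subP-fusion ρ σ υ h p)
  renT-subT-fusion ρ σ υ h (var i)  = h i
  renT-subT-fusion ρ σ υ h (mu t)   =
    cong mu (renT-subT-fusion (ext′ ρ) (exts σ) (exts υ) h′ t)
    where
      open ≡-Reasoning
      h′ : renT (ext′ ρ) ∘ exts σ ≗ exts υ
      h′ zero    = refl
      h′ (suc i) = begin
        renT (ext′ ρ) (renT suc (σ i)) ≡⟨ renT-fusion (ext′ ρ) suc (suc ∘ ρ) (λ _ → refl) (σ i) ⟩
        renT (suc ∘ ρ) (σ i)           ≡⟨ renT-fusion suc ρ (suc ∘ ρ) (λ _ → refl) (σ i) ⟨
        renT suc (renT ρ (σ i))        ≡⟨ cong (renT suc) (h i) ⟩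
        renT suc (υ i)                 ∎
  renP-subP-fusion ρ σ υ h (recv a b) =
    cong₂ recv (renT-subT-fusion ρ σ υ h a) (renT-subT-fusion ρ σ υ h b)
  renP-subP-fusion ρ σ υ h (send a b) =
    cong₂ send (renT-subT-fusion ρ σ υ h a) (renT-subT-fusion ρ σ υ h b)
  renP-subP-fusion ρ σ υ h (bra bs) = cong bra (renB-subB-fusion ρ σ υ h bs)
  renP-subP-fusion ρ σ υ h (sel bs) = cong sel (renB-subB-fusion ρ σ υ h bs)
  renB-subB-fusion ρ σ υ h []             = refl
  renB-subB-fusion ρ σ υ h ((l , t) ∷ bs) =
    cong₂ (λ t′ bs′ → (l , t′) ∷ bs′) (renT-subT-fusion ρ σ υ h t) (renB-subB-fusion ρ σ υ h bs)

  subT-fusion : ∀ τ σ υ → subT τ ∘ σ ≗ υ → (t : T) → subT τ (subT σ t) ≡ subT υ t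
  subP-fusion : ∀ τ σ υ → subT τ ∘ σ ≗ υ → (p : P) → subP τ (subP σ p) ≡ subP υ p
  subB-fusion : ∀ τ σ υ → subT τ ∘ σ ≗ υ → (bs : Bs) → subB τ (subB σ bs) ≡ subB υ bs
  subT-fusion τ σ υ h (bsc d)  = refl
  subT-fusion τ σ υ h end      = refl
  subT-fusion τ σ υ h (qp q p) = cong (qp q) (subP-fusion τ σ υ h p)
  subT-fusion τ σ υ h (var i)  = h i
  subT-fusion τ σ υ h (mu t)   = cong mu (subT-fusion (exts τ) (exts σ) (exts υ) h′ t)
    where
      open ≡-Reasoning
      h′ : subT (exts τ) ∘ exts σ ≗ exts υ
      h′ zero    = refl
      h′ (suc i) = begin
        subT (exts τ) (renT suc (σ i)) ≡⟨ subT-renT-fusion (exts τ) suc (renT suc ∘ τ) (λ _ → refl) (σ i) ⟩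
        subT (renT suc ∘ τ) (σ i)      ≡⟨ renT-subT-fusion suc τ (renT suc ∘ τ) (λ _ → refl) (σ i) ⟨
        renT suc (subT τ (σ i))        ≡⟨ cong (renT suc) (h i) ⟩
        renT suc (υ i)                 ∎
  subP-fusion τ σ υ h (recv a b) = cong₂ recv (subT-fusion τ σ υ h a) (subT-fusion τ σ υ h b)
  subP-fusion τ σ υ h (send a b) = cong₂ send (subT-fusion τ σ υ h a) (subT-fusion τ σ υ h b)
  subP-fusion τ σ υ h (bra bs)   = cong bra (subB-fusion τ σ υ h bs)
  subP-fusion τ σ υ h (sel bs)   = cong sel (subB-fusion τ σ υ h bs)
  subB-fusion τ σ υ h []             = refl
  subB-fusion τ σ υ h ((l , t) ∷ bs) =
    cong₂ (λ t′ bs′ → (l , t′) ∷ bs′) (subT-fusion τ σ υ h t) (subB-fusion τ σ υ h bs)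

  subT-id : ∀ σ → σ ≗ var → (t : T) → subT σ t ≡ t
  subP-id : ∀ σ → σ ≗ var → (p : P) → subP σ p ≡ p
  subB-id : ∀ σ → σ ≗ var → (bs : Bs) → subB σ bs ≡ bs
  subT-id σ h (bsc d)  = refl
  subT-id σ h end      = refl
  subT-id σ h (qp q p) = cong (qp q) (subP-id σ h p)
  subT-id σ h (var i)  = h i
  subT-id σ h (mu t)   = cong mu (subT-id (exts σ) h′ t)
    where
      h′ : exts σ ≗ var
      h′ zero    = refl
      h′ (suc i) = cong (renT suc) (h i)
  subP-id σ h (recv a b) = cong₂ recv (subT-id σ h a) (subT-id σ h b)
  subP-id σ h (send a b) = cong₂ send (subT-id σ h a) (subT-id σ h b)
  subP-id σ h (bra bs)   = cong bra (subB-id σ h bs)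
  subP-id σ h (sel bs)   = cong sel (subB-id σ h bs)
  subB-id σ h []             = refl
  subB-id σ h ((l , t) ∷ bs) = cong₂ (λ t′ bs′ → (l , t′) ∷ bs′) (subT-id σ h t) (subB-id σ h bs)

  exts-[]-fusion : ∀ σ u (t : T) → subT (exts σ) t [ u ] ≡ subT (u ∷ₛ σ) t
  exts-[]-fusion σ u = subT-fusion (single u) (exts σ) (u ∷ₛ σ) h
    where
      h : subT (single u) ∘ exts σ ≗ u ∷ₛ σ
      h zero    = refl
      h (suc i) = trans (subT-renT-fusion (single u) suc var (λ _ → refl) (σ i))
                        (subT-id var (λ _ → refl) (σ i))

  -- The subterms of t, with each free index i replaced by σ i and each variable bound by
  -- an enclosing μ replaced by that (instantiated) μ-type; un p also contributes lin p.
  closure  : (ℕ → T) → T → List T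
  closureP : (ℕ → T) → P → List T
  closureB : (ℕ → T) → Bs → List T
  closure σ (bsc d)  = bsc d ∷ []
  closure σ end      = end ∷ []
  closure σ (var i)  = σ i ∷ []
  closure σ (qp q p) = qp q (subP σ p) ∷ qp lin (subP σ p) ∷ closureP σ p
  closure σ (mu t)   = subT σ (mu t) ∷ closure (subT σ (mu t) ∷ₛ σ) t
  closureP σ (recv a b) = closure σ a ++ closure σ b
  closureP σ (send a b) = closure σ a ++ closure σ b
  closureP σ (bra bs)   = closureB σ bs
  closureP σ (sel bs)   = closureB σ bs
  closureB σ []             = []
  closureB σ ((l , t) ∷ bs) = closure σ t ++ closureB σ bs

  subT∈closure : ∀ σ t → subT σ t ∈ closure σ t
  subT∈closure σ (bsc d)  = here refl
  subT∈closure σ end      = here refl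
  subT∈closure σ (var i)  = here refl
  subT∈closure σ (qp q p) = here refl
  subT∈closure σ (mu t)   = here refl

  lookupLbl∈closureB : ∀ σ bs {l} (l∈ : l ∈ map proj₁ (subB σ bs)) →
                       lookupLbl (subB σ bs) l∈ ∈ closureB σ bs
  lookupLbl∈closureB σ ((_ , t) ∷ bs) (here _)  = ∈-++⁺ˡ (subT∈closure σ t)
  lookupLbl∈closureB σ ((_ , t) ∷ bs) (there l∈) = ∈-++⁺ʳ (closure σ t) (lookupLbl∈closureB σ bs l∈)

  infix 4 _↝_

  data _↝_ : T → T → Set where
    unfold-mu : ∀ {t} → mu t ↝ t [ mu t ]
    transition : ∀ {y} (α : B (proj₁ (cNoMu y))) → y ↝ proj₂ (cNoMu y) α

  module _ (L : List T) where

    StepsInto : T → Set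
    StepsInto y = ∀ {z} → y ↝ z → z ∈ L

    qp-StepsInto : ∀ σ q p → closureP σ p ⊆ L → qp lin (subP σ p) ∈ L →
                   StepsInto (qp q (subP σ p))
    qp-StepsInto σ lin (recv a b) sub _ (transition ⋆)   = sub (∈-++⁺ʳ (closure σ a) (subT∈closure σ b))
    qp-StepsInto σ lin (recv a b) sub _ (transition one) = sub (∈-++⁺ˡ (subT∈closure σ a))
    qp-StepsInto σ lin (send a b) sub _ (transition ⋆)   = sub (∈-++⁺ʳ (closure σ a) (subT∈closure σ b))
    qp-StepsInto σ lin (send a b) sub _ (transition one) = sub (∈-++⁺ˡ (subT∈closure σ a))
    qp-StepsInto σ lin (bra bs)   sub _ (transition (_ , l∈)) = sub (lookupLbl∈closureB σ bs l∈)
    qp-StepsInto σ lin (sel bs)   sub _ (transition (_ , l∈)) = sub (lookupLbl∈closureB σ bs l∈)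
    qp-StepsInto σ un  p          _   lin∈ (transition _)     = lin∈

    closure-StepsInto  : ∀ σ t → (∀ i → StepsInto (σ i)) →
                         closure σ t ⊆ L → All StepsInto (closure σ t)
    closureP-StepsInto : ∀ σ p → (∀ i → StepsInto (σ i)) →
                         closureP σ p ⊆ L → All StepsInto (closureP σ p)
    closureB-StepsInto : ∀ σ bs → (∀ i → StepsInto (σ i)) →
                         closureB σ bs ⊆ L → All StepsInto (closureB σ bs)
    closure-StepsInto σ (bsc d)  _ _ = (λ { (transition ()) }) ∷ []
    closure-StepsInto σ end      _ _ = (λ { (transition ()) }) ∷ []
    closure-StepsInto σ (var i)  h _ = h i ∷ []
    closure-StepsInto σ (qp q p) h sub =
      qp-StepsInto σ q p sub′ lin∈ ∷ qp-StepsInto σ lin p sub′ lin∈ ∷ closureP-StepsInto σ p h sub′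
      where
        sub′ : closureP σ p ⊆ L
        sub′ = sub ∘ there ∘ there
        lin∈ : qp lin (subP σ p) ∈ L
        lin∈ = sub (there (here refl))
    closure-StepsInto σ (mu t) h sub = head ∷ closure-StepsInto σ′ t h′ (sub ∘ there)
      where
        σ′ : ℕ → T
        σ′ = subT σ (mu t) ∷ₛ σ
        unfolded : subT σ′ t ≡ subT (exts σ) t [ subT σ (mu t) ]
        unfolded = sym (exts-[]-fusion σ (subT σ (mu t)) t)
        head : StepsInto (subT σ (mu t))
        head unfold-mu      = sub (there (subst (_∈ closure σ′ t) unfolded (subT∈closure σ′ t)))
        head (transition ())
        h′ : ∀ i → StepsInto (σ′ i)
        h′ zero    = head
        h′ (suc i) = h i
    closureP-StepsInto σ (recv a b) h sub = ++⁺ (closure-StepsInto σ a h (sub ∘ ∈-++⁺ˡ))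
                                                (closure-StepsInto σ b h (sub ∘ ∈-++⁺ʳ (closure σ a)))
    closureP-StepsInto σ (send a b) h sub = ++⁺ (closure-StepsInto σ a h (sub ∘ ∈-++⁺ˡ))
                                                (closure-StepsInto σ b h (sub ∘ ∈-++⁺ʳ (closure σ a)))
    closureP-StepsInto σ (bra bs) h sub = closureB-StepsInto σ bs h sub
    closureP-StepsInto σ (sel bs) h sub = closureB-StepsInto σ bs h sub
    closureB-StepsInto σ [] h sub = []
    closureB-StepsInto σ ((_ , t) ∷ bs) h sub =
      ++⁺ (closure-StepsInto σ t h (sub ∘ ∈-++⁺ˡ)) (closureB-StepsInto σ bs h (sub ∘ ∈-++⁺ʳ (closure σ t)))

  module _ {L : List T} (↝-closed : ∀ {y z} → y ∈ L → y ↝ z → z ∈ L) where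

    unfoldN-∈ : ∀ m {y} → y ∈ L → unfoldN m y ∈ L
    unfoldN-∈ zero             y∈ = y∈
    unfoldN-∈ (suc m) {mu t}   y∈ = unfoldN-∈ m (↝-closed y∈ unfold-mu)
    unfoldN-∈ (suc m) {bsc d}  y∈ = y∈
    unfoldN-∈ (suc m) {end}    y∈ = y∈
    unfoldN-∈ (suc m) {qp q p} y∈ = y∈
    unfoldN-∈ (suc m) {var i}  y∈ = y∈

    cType-closed : ∀ {y} → y ∈ L → (α : B (proj₁ (cType y))) → proj₂ (cType y) α ∈ L
    cType-closed {y} y∈ α = ↝-closed (unfoldN-∈ (muDepth y) y∈) (transition α)

  closure-↝-closed : ∀ t {y z} → y ∈ closure var t → y ↝ z → z ∈ closure var t
  closure-↝-closed t y∈ =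
    All.lookup (closure-StepsInto (closure var t) var t var-StepsInto (λ z∈ → z∈)) y∈
    where
      var-StepsInto : ∀ i → StepsInto (closure var t) (var i)
      var-StepsInto i (transition ())

  ∈closure : ∀ t → t ∈ closure var t
  ∈closure t = subst (_∈ closure var t) (subT-id var (λ _ → refl) t) (subT∈closure var t)

lemma1 : {D 𝕃 : Set} (T : Ty D 𝕃) → WellFormed T → Closed T → Contractive T →
         IsFinite (Gen cType T)
lemma1 T _ _ _ = isFinite-Gen cType (closure var T) (cType-closed (closure-↝-closed T)) (∈closure T)
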